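{- Let $G$ be a connected graph such that $\mathrm{Aut}(G[G])=\mathrm{Aut}(G)[\mathrm{Aut}(G)]$. Then $D'(G[G])\leq 2$.
   Context: All graphs are finite and simple. For a graph $X$, an edge labeling $\psi:E(X)\to\{1,\dots,d\}$ is distinguishing if the only automorphism of $X$ preserving all edge labels is the identity; the distinguishing index $D'(X)$ is the least $d$ such that $X$ has a distinguishing edge labeling with $d$ labels. The lexicographic product $G[H]$ has vertex set $V(G)\times V(H)$, with $(a,x)$ adjacent to $(b,y)$ iff $ab\in E(G)$, or $a=b$ and $xy\in E(H)$. The wreath product $\mathrm{Aut}(G)[\mathrm{Aut}(H)]$ is the subgroup of $\mathrm{Aut}(G[H])$ consisting of all maps $(g,h)\mapsto(\alpha g,\beta_g h)$ with $\alpha\in\mathrm{Aut}(G)$ and $\beta_g\in\mathrm{Aut}(H)$ for each $g\in V(G)$. -}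

module Defs where

open import Data.Nat using (ℕ)
open import Data.Fin using (Fin)
open import Data.Bool using (Bool; true; false; _∨_; _∧_)
open import Data.Product using (Σ; _×_; _,_; proj₁; proj₂; ∃)
open import Function.Bundles using (_↔_; Inverse)
open import Relation.Binary.PropositionalEquality using (_≡_)
open import Relation.Nullary using (Dec; yes; no)

record Graph (V : Set) : Set where
  field
    adj    : V → V → Bool
    adj-sym : ∀ u v → adj u v ≡ adj v u
    irrefl : ∀ v → adj v v ≡ false
open Graph public

FinGraph : ℕ → Set
FinGraph n = Graph (Fin n)

data Reach {V : Set} (G : Graph V) : V → V → Set where
  here : ∀ {u} → Reach G u u
  step : ∀ {u v w} → adj G u v ≡ true → Reach G v w → Reach G u w

Connected : {V : Set} → Graph V → Set
Connected {V} G = ∀ (u v : V) → Reach G u v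

record Aut {V : Set} (G : Graph V) : Set where
  field
    perm     : V ↔ V
    preserve : ∀ u v → adj G (Inverse.to perm u) (Inverse.to perm v) ≡ adj G u v

  app : V → V
  app = Inverse.to perm
open Aut public

module _ {A B : Set} (_≟A_ : (x y : A) → Dec (x ≡ y)) where
  eqb : A → A → Bool
  eqb x y with x ≟A y
  ... | yes _ = true
  ... | no  _ = false

lexProduct : ∀ {n} {W : Set} → FinGraph n → Graph W → Graph (Fin n × W)
lexProduct {n} G H = record
  { adj    = λ p q → adj G (proj₁ p) (proj₁ q) ∨ (eqF (proj₁ p) (proj₁ q) ∧ adj H (proj₂ p) (proj₂ q))
  ; adj-sym = symP
  ; irrefl = irrP
  }
  where
  open import Data.Fin.Properties using (_≟_)
  open import Relation.Binary.PropositionalEquality using (refl; cong₂; sym)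
  open import Relation.Nullary using (¬_)
  eqF : Fin n → Fin n → Bool
  eqF x y = eqb {B = Fin n} _≟_ x y
  eqF-sym : ∀ x y → eqF x y ≡ eqF y x
  eqF-sym x y with x ≟ y | y ≟ x
  ... | yes _ | yes _ = refl
  ... | no _  | no _  = refl
  ... | yes e | no ne = Data.Empty.⊥-elim (ne (sym e)) where import Data.Empty
  ... | no ne | yes e = Data.Empty.⊥-elim (ne (sym e)) where import Data.Empty
  symP : ∀ p q → _ ≡ _
  symP (a , x) (b , y) = cong₂ _∨_ (Graph.adj-sym G a b) (cong₂ _∧_ (eqF-sym a b) (Graph.adj-sym H x y))
  irrP : ∀ p → _ ≡ false
  irrP (a , x) rewrite Graph.irrefl G a | Graph.irrefl H x with eqF a a
  ... | true = refl
  ... | false = refl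

_[_] : ∀ {n} {W : Set} → FinGraph n → Graph W → Graph (Fin n × W)
G [ H ] = lexProduct G H

InWreath : ∀ {n} {W : Set} (G : FinGraph n) (H : Graph W) → Aut (G [ H ]) → Set
InWreath {n} {W} G H φ =
  Σ (Aut G) λ α → Σ (Fin n → Aut H) λ β →
    ∀ (g : Fin n) (h : W) → app φ (g , h) ≡ (app α g , app (β g) h)

-- Aut(G[H]) = Aut(G)[Aut(H)] (the inclusion ⊇ always holds).
AutLexIsWreath : ∀ {n} {W : Set} (G : FinGraph n) (H : Graph W) → Set
AutLexIsWreath G H = ∀ (φ : Aut (G [ H ])) → InWreath G H φ

-- Edge labelings with labels in {1,…,d} (represented as Fin d).
-- Labels are given on all ordered pairs, symmetric; only values on edges matter.
record EdgeLabeling {V : Set} (X : Graph V) (d : ℕ) : Set where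
  field
    label     : V → V → Fin d
    label-sym : ∀ u v → label u v ≡ label v u
open EdgeLabeling public

PreservesLabels : ∀ {V : Set} {X : Graph V} {d} → EdgeLabeling X d → Aut X → Set
PreservesLabels {V} {X} ψ σ =
  ∀ (u v : V) → adj X u v ≡ true → label ψ (app σ u) (app σ v) ≡ label ψ u v

Distinguishing : ∀ {V : Set} {X : Graph V} {d} → EdgeLabeling X d → Set
Distinguishing {V} {X} ψ = ∀ (σ : Aut X) → PreservesLabels ψ σ → ∀ (x : V) → app σ x ≡ x

DistIndexAtMost : ∀ {V : Set} → Graph V → ℕ → Set
DistIndexAtMost X d = Σ (EdgeLabeling X d) Distinguishing

module Submission where

-- Identify V(G) with the chain Fin N and label an edge of G[G] by
--   * inside a fibre {g} × V:  1 iff one endpoint is the diagonal vertex (g,g)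
--     (a "star" at (g,g)),
--   * between fibres, (g,x)(h,y):  1 iff x + y ≥ N - 1 (a "cross" test).
-- A label-preserving automorphism σ has the wreath form (g,x) ↦ (α g, β_g x).
-- For adjacent g, h the cross labels force  cross (β_g x) (β_h y) = cross x y,
-- and an order argument on the finite chain (rigidity of Fin N) shows that
-- this forces β_g = id.  Then σ moves fibres as α does, and the star labels
-- show that if α g = k ≠ g, the neighbours of g are all k and vice versa, so
-- {g, k} is a connected component — impossible when N ≥ 3.  For N ≤ 1 every
-- labeling is distinguishing, and for N = 2 (G = K₂, G[G] = K₄) the wreath
-- hypothesis fails, as swapping coordinates shows.

open import Defs
open import Data.Nat using (ℕ; zero; suc; s≤s; z≤n) renaming (_<_ to _<ℕ_)
open import Data.Nat.Properties using (∸-monoʳ-≤; <⇒≤; ≮⇒≥)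
open import Data.Fin using (Fin; zero; suc; opposite; _≤_; _<_)
open import Data.Fin.Properties
  using (_≟_; _≤?_; _<?_; ≤-refl; 0≢1+n; ≤∧≢⇒<; <⇒≢; opposite-prop; opposite-involutive; pigeonhole; 2↔Bool)
open import Data.Fin.Induction using (<-wellFounded)
open import Data.Bool using (Bool; true; false; _∨_; _∧_; not)
open import Data.Bool.Properties using (∨-comm; ∧-comm)
open import Data.Product using (∃; _×_; _,_; proj₁; proj₂; swap)
open import Data.Sum using (_⊎_; inj₁; inj₂)
open import Function using (_∘_)
open import Function.Bundles using (_↔_; Inverse; Injection; _⇔_; mk⇔; mk↔ₛ′; Equivalence)
open import Function.Construct.Composition using (_↔-∘_)
open import Function.Properties.Inverse using (↔⇒↣; ↔-sym)
open import Induction.WellFounded as WF using ()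
open import Relation.Nullary using (Dec; yes; no; ¬_; does; contradiction)
open import Relation.Nullary.Decidable using (dec-true; dec-false; does-⇔)
open import Relation.Binary.PropositionalEquality
  using (_≡_; _≢_; refl; sym; trans; cong; subst; subst₂; module ≡-Reasoning)

open Inverse using (to; from; strictlyInverseˡ)

↔-injective : ∀ {A B : Set} (P : A ↔ B) {a b : A} → to P a ≡ to P b → a ≡ b
↔-injective P = Injection.injective (↔⇒↣ P)

does-true : ∀ {A : Set} (a? : Dec A) → does a? ≡ true → A
does-true (yes a) _ = a
does-true (no _) ()

does-≡⇒⇔ : ∀ {A B : Set} (a? : Dec A) (b? : Dec B) → does a? ≡ does b? → A ⇔ B
does-≡⇒⇔ a? b? same = mk⇔
  (λ a → does-true b? (trans (sym same) (dec-true a? a)))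
  (λ b → does-true a? (trans same (dec-true b? b)))

module _ {N : ℕ} where

  -- Strong induction for fixed points: an injective τ that, at each x, stays
  -- below x once it fixes every y < x, fixes everything.  (If τ x < x, then
  -- τ fixes τ x, so τ (τ x) = τ x and injectivity gives τ x = x.)
  fixes-all : (τ : Fin N → Fin N) → (∀ {a b} → τ a ≡ τ b → a ≡ b) →
              (∀ x → (∀ {y} → y < x → τ y ≡ y) → τ x ≤ x) → ∀ x → τ x ≡ x
  fixes-all τ injective below = WF.All.wfRec <-wellFounded _ (λ x → τ x ≡ x) fixed
    where
    fixed : ∀ x → (∀ {y} → y < x → τ y ≡ y) → τ x ≡ x
    fixed x ih with τ x ≟ x
    ... | yes τx≡x = τx≡x
    ... | no τx≢x = contradiction (injective (ih (≤∧≢⇒< (below x ih) τx≢x))) τx≢x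

  -- The only monotone permutation of a finite chain is the identity: below a
  -- point x fixed by induction, the preimage of x cannot lie under x, so
  -- x ≤ P⁻¹ x and monotonicity gives P x ≤ x.
  monotone-permutation-id : (P : Fin N ↔ Fin N) → (∀ {z x} → z ≤ x → to P z ≤ to P x) →
                            ∀ x → to P x ≡ x
  monotone-permutation-id P monotone = fixes-all (to P) (↔-injective P) below
    where
    below : ∀ x → (∀ {y} → y < x → to P y ≡ y) → to P x ≤ x
    below x ih with from P x <? x
    ... | yes w<x = contradiction (trans (sym (ih w<x)) (strictlyInverseˡ P x)) (<⇒≢ w<x)
    ... | no w≮x  = subst (to P x ≤_) (strictlyInverseˡ P x)
                      (monotone (≮⇒≥ w≮x))

  -- If permutations P, R satisfy  R z ≤ P x ⇔ z ≤ x, then P is the identity: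
  -- R⁻¹ ∘ P is deflationary, hence the identity, so R = P and P is monotone.
  interlocked-permutation-id : (P R : Fin N ↔ Fin N) →
                               (∀ z x → to R z ≤ to P x ⇔ z ≤ x) → ∀ x → to P x ≡ x
  interlocked-permutation-id P R interlocked = monotone-permutation-id P monotone
    where
    R⁻¹P-id : ∀ x → from R (to P x) ≡ x
    R⁻¹P-id = fixes-all (from R ∘ to P) (↔-injective P ∘ ↔-injective (↔-sym R))
      λ x _ → Equivalence.to (interlocked (from R (to P x)) x)
                (subst (_≤ to P x) (sym (strictlyInverseˡ R (to P x))) ≤-refl)
    R≡P : ∀ x → to R x ≡ to P x
    R≡P x = trans (cong (to R) (sym (R⁻¹P-id x))) (strictlyInverseˡ R (to P x))
    monotone : ∀ {z x} → z ≤ x → to P z ≤ to P x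
    monotone {z} {x} z≤x = subst (_≤ to P x) (R≡P z) (Equivalence.from (interlocked z x) z≤x)

module _ {N : ℕ} where

  opposite-anti : {x y : Fin N} → x ≤ y → opposite y ≤ opposite x
  opposite-anti {x} {y} x≤y rewrite opposite-prop x | opposite-prop y = ∸-monoʳ-≤ N (s≤s x≤y)

  opposite↔ : Fin N ↔ Fin N
  opposite↔ = mk↔ₛ′ opposite opposite opposite-involutive opposite-involutive

  -- x and y are "across" each other when x + y ≥ N - 1, i.e. N - 1 - y ≤ x.
  Across : Fin N → Fin N → Set
  Across x y = opposite y ≤ x

  cross : Fin N → Fin N → Bool
  cross x y = does (opposite y ≤? x)

  across-sym : ∀ x y → Across x y → Across y x
  across-sym x y oy≤x = subst (opposite x ≤_) (opposite-involutive y) (opposite-anti oy≤x)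

  cross-sym : ∀ x y → cross x y ≡ cross y x
  cross-sym x y = does-⇔ (mk⇔ (across-sym x y) (across-sym y x)) (opposite y ≤? x) (opposite x ≤? y)

  -- If two permutations P, Q preserve the cross test, cross (P x) (Q y) = cross x y,
  -- then P is the identity: with R = opposite ∘ Q ∘ opposite the test reads
  -- R z ≤ P x ⇔ z ≤ x.
  cross-rigid : (P Q : Fin N ↔ Fin N) → (∀ x y → cross (to P x) (to Q y) ≡ cross x y) →
                ∀ x → to P x ≡ x
  cross-rigid P Q preserved = interlocked-permutation-id P R interlocked
    where
    R : Fin N ↔ Fin N
    R = opposite↔ ↔-∘ (Q ↔-∘ opposite↔)
    interlocked : ∀ z x → to R z ≤ to P x ⇔ z ≤ x
    interlocked z x with does-≡⇒⇔ (opposite (to Q (opposite z)) ≤? to P x)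
                                  (opposite (opposite z) ≤? x) (preserved x (opposite z))
    ... | across rewrite opposite-involutive z = across

lex-adj : ∀ {n} {W : Set} (G : FinGraph n) (H : Graph W) (g h : Fin n) (x y : W) →
          adj (G [ H ]) (g , x) (h , y) ≡ adj G g h ∨ (does (g ≟ h) ∧ adj H x y)
lex-adj G H g h x y with g ≟ h
... | yes _ = refl
... | no _  = refl

across-edge : ∀ {n} {W : Set} (G : FinGraph n) (H : Graph W) {g h : Fin n} (x y : W) →
              adj G g h ≡ true → adj (G [ H ]) (g , x) (h , y) ≡ true
across-edge G H {g} {h} x y g~h rewrite lex-adj G H g h x y | g~h = refl

fibre-edge : ∀ {n} {W : Set} (G : FinGraph n) (H : Graph W) (g : Fin n) {x y : W} →
             adj H x y ≡ true → adj (G [ H ]) (g , x) (g , y) ≡ true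
fibre-edge G H g {x} {y} x~y
  rewrite lex-adj G H g g x y | irrefl G g | dec-true (g ≟ g) refl | x~y = refl

adj⇒≢ : ∀ {V : Set} (G : Graph V) {u v : V} → adj G u v ≡ true → u ≢ v
adj⇒≢ G {u} u~u refl = contradiction (trans (sym (irrefl G u)) u~u) λ ()

neighbour : ∀ {V : Set} (G : Graph V) → Connected G → {u : V} (v : V) → u ≢ v →
            ∃ λ w → adj G u w ≡ true
neighbour G connected {u} v u≢v with connected u v
... | here = contradiction refl u≢v
... | step {v = w} u~w _ = w , u~w

has-neighbour : ∀ {N} (G : FinGraph N) → Connected G → 1 <ℕ N → (g : Fin N) →
                ∃ λ h → adj G g h ≡ true
has-neighbour G connected (s≤s (s≤s z≤n)) zero    = neighbour G connected (suc zero) λ ()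
has-neighbour G connected (s≤s (s≤s z≤n)) (suc g) = neighbour G connected zero λ ()

reach-closed : ∀ {V : Set} (G : Graph V) (P : V → Set) →
               (∀ {u v} → adj G u v ≡ true → P u → P v) → ∀ {u w} → Reach G u w → P u → P w
reach-closed G P closed here pu = pu
reach-closed G P closed (step u~v walk) pu = reach-closed G P closed walk (closed u~v pu)

-- Two vertices cannot cover a chain with more than two points (pigeonhole on
-- the indicator of g).
no-two-vertex-cover : ∀ {N} → 2 <ℕ N → (g k : Fin N) → ¬ (∀ t → t ≡ g ⊎ t ≡ k)
no-two-vertex-cover 2<N g k cover
  with i , j , i<j , same ← pigeonhole 2<N (from 2↔Bool ∘ λ t → does (t ≟ g))
  = <⇒≢ i<j (i≡j (cover i) (cover j))
  where
  i≡g⇔j≡g : i ≡ g ⇔ j ≡ g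
  i≡g⇔j≡g = does-≡⇒⇔ (i ≟ g) (j ≟ g) (↔-injective (↔-sym 2↔Bool) same)
  i≡j : i ≡ g ⊎ i ≡ k → j ≡ g ⊎ j ≡ k → i ≡ j
  i≡j (inj₁ i≡g) _          = trans i≡g (sym (Equivalence.to i≡g⇔j≡g i≡g))
  i≡j (inj₂ _)   (inj₁ j≡g) = trans (Equivalence.from i≡g⇔j≡g j≡g) (sym j≡g)
  i≡j (inj₂ i≡k) (inj₂ j≡k) = trans i≡k (sym j≡k)

module _ {N : ℕ} where

  star : Fin N → Fin N → Fin N → Bool
  star g x y = does (x ≟ g) ∨ does (y ≟ g)

  star-centre : ∀ g y → star g g y ≡ true
  star-centre g y rewrite dec-true (g ≟ g) refl = refl

  star-off-centre : ∀ {g x y} → x ≢ g → star g x y ≡ true → y ≡ g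
  star-off-centre {g} {x} {y} x≢g in-star rewrite dec-false (x ≟ g) x≢g = does-true (y ≟ g) in-star

  lex-label : Fin N × Fin N → Fin N × Fin N → Bool
  lex-label (g , x) (h , y) with g ≟ h
  ... | yes _ = star g x y
  ... | no _  = cross x y

  lex-label-fibre : ∀ g x y → lex-label (g , x) (g , y) ≡ star g x y
  lex-label-fibre g x y with g ≟ g
  ... | yes _   = refl
  ... | no g≢g = contradiction refl g≢g

  lex-label-across : ∀ {g h} x y → g ≢ h → lex-label (g , x) (h , y) ≡ cross x y
  lex-label-across {g} {h} x y g≢h with g ≟ h
  ... | yes g≡h = contradiction g≡h g≢h
  ... | no _    = refl

  lex-label-sym : ∀ u v → lex-label u v ≡ lex-label v u
  lex-label-sym (g , x) (h , y) with g ≟ h | h ≟ g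
  ... | yes refl | yes _   = ∨-comm (does (x ≟ g)) (does (y ≟ g))
  ... | yes g≡h  | no h≢g  = contradiction (sym g≡h) h≢g
  ... | no g≢h   | yes h≡g = contradiction (sym h≡g) g≢h
  ... | no _     | no _    = cross-sym x y

  lex-labeling : {X : Graph (Fin N × Fin N)} → EdgeLabeling X 2
  lex-labeling = record
    { label     = λ u v → from 2↔Bool (lex-label u v)
    ; label-sym = λ u v → cong (from 2↔Bool) (lex-label-sym u v)
    }

module _ {N : ℕ} (G : FinGraph N) (connected : Connected G) (2<N : 2 <ℕ N) where

  module WreathRigid (σ : Aut (G [ G ])) (preserves : PreservesLabels (lex-labeling {X = G [ G ]}) σ)
                     (α : Aut G) (β : Fin N → Aut G)
                     (σ-form : ∀ g x → app σ (g , x) ≡ (app α g , app (β g) x)) where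
    open ≡-Reasoning

    preserved-under : (f : Fin N × Fin N → Fin N × Fin N) → (∀ u → app σ u ≡ f u) →
                      ∀ {u v} → adj (G [ G ]) u v ≡ true → lex-label (f u) (f v) ≡ lex-label u v
    preserved-under f σ≡f {u} {v} u~v =
      subst₂ (λ a b → lex-label a b ≡ lex-label u v) (σ≡f u) (σ≡f v)
             (↔-injective (↔-sym 2↔Bool) (preserves u v u~v))

    -- Each β_g is trivial: between g and a neighbour h the cross labels give
    -- cross (β_g x) (β_h y) = cross x y.
    fibre-fixed : ∀ g x → app (β g) x ≡ x
    fibre-fixed g = cross-rigid (perm (β g)) (perm (β h)) cross-preserved
      where
      h : Fin N
      h = proj₁ (has-neighbour G connected (<⇒≤ 2<N) g)
      g~h : adj G g h ≡ true
      g~h = proj₂ (has-neighbour G connected (<⇒≤ 2<N) g)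
      g≢h : g ≢ h
      g≢h = adj⇒≢ G g~h
      cross-preserved : ∀ x y → cross (app (β g) x) (app (β h) y) ≡ cross x y
      cross-preserved x y = begin
        cross (app (β g) x) (app (β h) y)
          ≡⟨ lex-label-across _ _ (g≢h ∘ ↔-injective (perm α)) ⟨
        lex-label (app α g , app (β g) x) (app α h , app (β h) y)
          ≡⟨ preserved-under _ (λ (g , x) → σ-form g x) (across-edge G G x y g~h) ⟩
        lex-label (g , x) (h , y)
          ≡⟨ lex-label-across x y g≢h ⟩
        cross x y ∎

    σ-shift : ∀ g x → app σ (g , x) ≡ (app α g , x)
    σ-shift g x = trans (σ-form g x) (cong (app α g ,_) (fibre-fixed g x))

    -- α is trivial: if α g = k ≠ g, the star labels make {g, k} closed under
    -- adjacency, hence (G connected) all of V(G), contradicting N ≥ 3.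
    base-fixed : ∀ g → app α g ≡ g
    base-fixed g with app α g ≟ g
    ... | yes αg≡g = αg≡g
    ... | no k≢g = contradiction (λ t → reach-closed G InPair closed (connected g t) (inj₁ refl))
                                 (no-two-vertex-cover 2<N g k)
      where
      k : Fin N
      k = app α g
      InPair : Fin N → Set
      InPair t = t ≡ g ⊎ t ≡ k
      star-preserved : ∀ {x y} → adj G x y ≡ true → star k x y ≡ star g x y
      star-preserved {x} {y} x~y = begin
        star k x y                ≡⟨ lex-label-fibre k x y ⟨
        lex-label (k , x) (k , y) ≡⟨ preserved-under _ (λ (g , x) → σ-shift g x) (fibre-edge G G g x~y) ⟩
        lex-label (g , x) (g , y) ≡⟨ lex-label-fibre g x y ⟩
        star g x y                ∎
      closed : ∀ {u v} → adj G u v ≡ true → InPair u → InPair v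
      closed {v = v} g~v (inj₁ refl) =
        inj₂ (star-off-centre (k≢g ∘ sym) (trans (star-preserved g~v) (star-centre g v)))
      closed {v = v} k~v (inj₂ refl) =
        inj₁ (star-off-centre k≢g (trans (sym (star-preserved k~v)) (star-centre k v)))

    σ-id : ∀ u → app σ u ≡ u
    σ-id (g , x) = trans (σ-shift g x) (cong (_, x) (base-fixed g))

  lex-distinguishing : AutLexIsWreath G G → Distinguishing (lex-labeling {X = G [ G ]})
  lex-distinguishing wreath σ preserves with α , β , σ-form ← wreath σ =
    WreathRigid.σ-id σ preserves α β σ-form

k2-adj : (G : FinGraph 2) → Connected G → ∀ a b → adj G a b ≡ not (does (a ≟ b))
k2-adj G connected = complete
  where
  edge : adj G zero (suc zero) ≡ true
  edge with neighbour G connected {zero} (suc zero) (λ ())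
  ... | zero , 0~0     = contradiction refl (adj⇒≢ G 0~0)
  ... | suc zero , 0~1 = 0~1
  complete : ∀ a b → adj G a b ≡ not (does (a ≟ b))
  complete zero       zero       = irrefl G zero
  complete zero       (suc zero) = edge
  complete (suc zero) zero       = trans (adj-sym G (suc zero) zero) edge
  complete (suc zero) (suc zero) = irrefl G (suc zero)

-- In K₂[K₂] = K₄ two vertices are adjacent iff they differ in some coordinate.
not-∧-expand : ∀ p q → not p ∨ (p ∧ not q) ≡ not (p ∧ q)
not-∧-expand false q = refl
not-∧-expand true  q = refl

coordinate-swap : (G : FinGraph 2) → Connected G → Aut (G [ G ])
coordinate-swap G connected = record
  { perm     = mk↔ₛ′ swap swap (λ _ → refl) (λ _ → refl)
  ; preserve = swap-preserves
  }
  where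
  swap-preserves : ∀ u v → adj (G [ G ]) (swap u) (swap v) ≡ adj (G [ G ]) u v
  swap-preserves (a , x) (b , y)
    rewrite lex-adj G G x y a b | lex-adj G G a b x y
          | k2-adj G connected x y | k2-adj G connected a b = begin
    not (does (x ≟ y)) ∨ (does (x ≟ y) ∧ not (does (a ≟ b))) ≡⟨ not-∧-expand (does (x ≟ y)) _ ⟩
    not (does (x ≟ y) ∧ does (a ≟ b))                         ≡⟨ cong not (∧-comm (does (x ≟ y)) _) ⟩
    not (does (a ≟ b) ∧ does (x ≟ y))                         ≡⟨ not-∧-expand (does (a ≟ b)) _ ⟨
    not (does (a ≟ b)) ∨ (does (a ≟ b) ∧ not (does (x ≟ y))) ∎
    where open ≡-Reasoning

-- The swap is not of wreath form: it sends (0,0) and (0,1) to different fibres.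
k2-not-wreath : (G : FinGraph 2) → Connected G → ¬ AutLexIsWreath G G
k2-not-wreath G connected wreath with _ , _ , σ-form ← wreath (coordinate-swap G connected) =
  0≢1+n (trans (cong proj₁ (σ-form zero zero)) (sym (cong proj₁ (σ-form zero (suc zero)))))

subsingleton-distinguishing : ∀ {V : Set} {X : Graph V} {d} (ψ : EdgeLabeling X d) →
                              (∀ (u v : V) → u ≡ v) → Distinguishing ψ
subsingleton-distinguishing ψ unique σ _ x = unique (app σ x) x

corollary3p7 : ∀ (n : ℕ) (G : FinGraph n) → Connected G → AutLexIsWreath G G → DistIndexAtMost (G [ G ]) 2
corollary3p7 0 G _ _ =
  lex-labeling , subsingleton-distinguishing lex-labeling λ { (() , _) }
corollary3p7 1 G _ _ =
  lex-labeling , subsingleton-distinguishing lex-labeling λ { (zero , zero) (zero , zero) → refl }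
corollary3p7 2 G connected wreath = contradiction wreath (k2-not-wreath G connected)
corollary3p7 (suc (suc (suc m))) G connected wreath =
  lex-labeling , lex-distinguishing G connected (s≤s (s≤s (s≤s z≤n))) wreath
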